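{- Let $x=(\mathcal F_m,\mathcal G_m)$ be a point of the special fiber $\mathrm{M}^{\mathrm{spl}}\otimes_{O_F}k$ with values in a field $\kappa\supset k$. Let $h=\dim_\kappa t\mathcal F_m$ and $l=\dim_\kappa(\mathcal G_m\cap\mathcal G_m^{\perp'})$ (notation in context). Then $0\le h\le l\le s$ and $l\equiv s \pmod 2$.
   Context: Setting: - $F_0$ is a complete discretely valued field with ring of integers $O_{F_0}$, perfect residue field $k$ of characteristic $\neq2$; $F/F_0$ is a ramified quadratic extension with uniformizer $\pi$, $\pi^2\in F_0$ a uniformizer. - $V$ is an $F$-vector space of dimension $n=2m>3$ with hermitian form $\phi$ and basis $e_i$ such that $\phi(e_i,e_{n+1-j})=\delta_{ij}$. - $(x,y)=\tfrac12\mathrm{Tr}_{F/F_0}\phi(x,y)$, and $\Lambda_m=\mathrm{span}_{O_F}\{\pi^{ -1}e_1,\dots,\pi^{ -1}e_m,e_{m+1},\dots,e_n\}$, which is self-dual for $(\,,\,)$. - $r\ge s\ge0$ with $r+s=n$. - $t=\pi\otimes1$ on $\Lambda_m\otimes_{O_{F_0}}\mathcal O_S$, and $\pi$ denotes multiplication by the image of $\pi$ in $\mathcal O_S$. $\mathrm{M}^{\mathrm{spl}}$ is the projective $O_F$-scheme whose $S$-points are the pairs $(\mathcal F_m,\mathcal G_m)$ of locally direct summands of $\Lambda_m\otimes\mathcal O_S$, of ranks $n$ and $s$, with: - $\mathcal G_m\subset\mathcal F_m$; - $\mathcal F_m=\mathcal F_m^\perp$ for $(\,,\,)$; - $(t+\pi)\mathcal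 F_m\subset\mathcal G_m$ and $(t-\pi)\mathcal G_m=0$; - the rank of $t+\pi$ on $\mathcal F_m$ has the parity of $s$. On the special fiber, $\pi=0$, so $\mathcal G_m\subset t(\Lambda_m\otimes\kappa)$. The modified pairing on $t(\Lambda_m\otimes\kappa)$ is $\{tx,ty\}=(tx,y)$, and $\mathcal G_m^{\perp'}\subset t(\Lambda_m\otimes\kappa)$ is the orthogonal of $\mathcal G_m$ for $\{\,,\,\}$. -}

module Defs where

open import Level using (Level; _⊔_)
open import Algebra.Bundles using (CommutativeRing)
open import Data.Nat as ℕ using (ℕ; _<ᵇ_)
open import Data.Fin using (Fin; zero; suc; toℕ; opposite; _↑ˡ_; _↑ʳ_; splitAt)
open import Data.Bool using (if_then_else_)
open import Data.Sum using (inj₁; inj₂)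
open import Data.Product using (Σ; ∃; _×_; _,_)
open import Relation.Nullary using (¬_)
open import Relation.Binary.PropositionalEquality using (_≡_)

IsField : ∀ {c ℓ} → CommutativeRing c ℓ → Set (c ⊔ ℓ)
IsField R = ¬ (1# ≈ 0#) × (∀ x → ¬ (x ≈ 0#) → Σ Carrier λ y → x * y ≈ 1#)
  where open CommutativeRing R

CharNot2 : ∀ {c ℓ} → CommutativeRing c ℓ → Set ℓ
CharNot2 R = ¬ (1# + 1# ≈ 0#)
  where open CommutativeRing R

module LinAlg {c ℓ} (κ : CommutativeRing c ℓ) where
  open CommutativeRing κ using (Carrier; _≈_; _+_; _*_; -_; _-_; 0#; 1#)

  ∑ : ∀ {d} → (Fin d → Carrier) → Carrier
  ∑ {ℕ.zero}  f = 0#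
  ∑ {ℕ.suc d} f = f zero + ∑ (λ i → f (suc i))

  Vect : ℕ → Set c
  Vect d = Fin d → Carrier

  _≈ᵛ_ : ∀ {d} → Vect d → Vect d → Set ℓ
  u ≈ᵛ v = ∀ i → u i ≈ v i

  0ᵛ : ∀ {d} → Vect d
  0ᵛ _ = 0#

  _+ᵛ_ : ∀ {d} → Vect d → Vect d → Vect d
  (u +ᵛ v) i = u i + v i

  _·_ : ∀ {d} → Carrier → Vect d → Vect d
  (a · v) i = a * v i

  record IsSubspace {d} (W : Vect d → Set (c ⊔ ℓ)) : Set (c ⊔ ℓ) where
    field
      ∈-resp   : ∀ {u v} → u ≈ᵛ v → W u → W v
      ∈-0      : W 0ᵛ
      ∈-+      : ∀ {u v} → W u → W v → W (u +ᵛ v)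
      ∈-·      : ∀ a {v} → W v → W (a · v)

  lincomb : ∀ {d k} → (Fin k → Carrier) → (Fin k → Vect d) → Vect d
  lincomb coef b j = ∑ (λ i → coef i * b i j)

  record IsBasis {d k} (W : Vect d → Set (c ⊔ ℓ)) (b : Fin k → Vect d) : Set (c ⊔ ℓ) where
    field
      inW      : ∀ i → W (b i)
      indep    : ∀ coef → lincomb coef b ≈ᵛ 0ᵛ → ∀ i → coef i ≈ 0#
      spanning : ∀ v → W v → Σ (Fin k → Carrier) λ coef → v ≈ᵛ lincomb coef b

  HasDim : ∀ {d} → (Vect d → Set (c ⊔ ℓ)) → ℕ → Set (c ⊔ ℓ)
  HasDim {d} W k = Σ (Fin k → Vect d) λ b → IsBasis W b

-- Λ_m ⊗_{O_{F_0}} κ for a field κ ⊃ k (so π ↦ 0 and π² ↦ 0 in κ), n = 2m.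
-- Let f_i = π⁻¹ e_i (i ≤ m), f_i = e_i (i > m): an O_F-basis of Λ_m.  Then
-- f_1,…,f_n, πf_1,…,πf_n is a κ-basis of Λ_m ⊗ κ ≅ κ^(n+n); coordinate
-- (i ↑ˡ n) is the coefficient of f_i, coordinate (n ↑ʳ i) that of π f_i.
-- (Indices are 0-based: Fin n = {0,…,n-1}, basis index i+1 ↔ Fin-index i.)

module Lattice {c ℓ} (κ : CommutativeRing c ℓ) (m : ℕ) where
  open CommutativeRing κ using (Carrier; _≈_; _+_; _*_; -_; _-_; 0#; 1#)
  open LinAlg κ public

  n : ℕ
  n = m ℕ.+ m

  Λκ : Set c
  Λκ = Vect (n ℕ.+ n)

  -- t = π ⊗ 1 :  f_i ↦ π f_i,  π f_i ↦ π² f_i = 0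
  t : Λκ → Λκ
  t v j with splitAt n j
  ... | inj₁ i = 0#
  ... | inj₂ i = v (i ↑ˡ n)

  cf : Λκ → Fin n → Carrier
  cf v i = v (i ↑ˡ n)
  cπf : Λκ → Fin n → Carrier
  cπf v i = v (n ↑ʳ i)

  ε : Fin n → Carrier
  ε i = if toℕ i <ᵇ m then 1# else - 1#

  -- (x , y) = ½ Tr_{F/F0} φ(x,y), base-changed to κ.  On the basis the only
  -- nonzero values are (π f_i , f_{n+1-i}) = ε i and (f_i , π f_{n+1-i}) = - ε i
  -- (φ(f_i,f_{n+1-i}) = π⁻¹ if i ≤ m, -π⁻¹ if i > m; φ is hermitian, π̄ = -π).
  ⟪_,_⟫ : Λκ → Λκ → Carrier
  ⟪ x , y ⟫ = ∑ (λ i → ε i * (cπf x i * cf y (opposite i) - cf x i * cπf y (opposite i)))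

  _⊥ : (Λκ → Set (c ⊔ ℓ)) → (Λκ → Set (c ⊔ ℓ))
  (W ⊥) y = ∀ x → W x → ⟪ x , y ⟫ ≈ 0#

  tImage : (Λκ → Set (c ⊔ ℓ)) → (Λκ → Set (c ⊔ ℓ))
  tImage W w = Σ Λκ λ x → W x × (w ≈ᵛ t x)

  tΛ : Λκ → Set (c ⊔ ℓ)
  tΛ w = Σ Λκ λ x → w ≈ᵛ t x

  -- the modified pairing {t x , t y} = (t x , y) on t(Λ_m ⊗ κ), and
  -- G^⊥' = { w ∈ t(Λ_m ⊗ κ) | {w , g} = 0 for all g ∈ G }
  -- (for g = t y, {w , g} = (w , y); this is independent of the choice of y).
  _⊥′ : (Λκ → Set (c ⊔ ℓ)) → (Λκ → Set (c ⊔ ℓ))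
  (G ⊥′) w = tΛ w × (∀ g → G g → ∀ y → g ≈ᵛ t y → ⟪ w , y ⟫ ≈ 0#)

  _∩_ : (Λκ → Set (c ⊔ ℓ)) → (Λκ → Set (c ⊔ ℓ)) → (Λκ → Set (c ⊔ ℓ))
  (U ∩ W) v = U v × W v

  -- κ-points of the special fiber of M^spl: pairs (F_m, G_m) of subspaces of
  -- Λ_m ⊗ κ of dimensions n and s, with G ⊂ F, F = F^⊥, (t+π)F = tF ⊂ G,
  -- (t-π)G = tG = 0, and rank of t+π (= t) on F ≡ s mod 2.
  record SpecialFiberPoint (s : ℕ) (F G : Λκ → Set (c ⊔ ℓ)) : Set (c ⊔ ℓ) where
    field
      F-sub     : IsSubspace F
      G-sub     : IsSubspace G
      F-dim     : HasDim F n
      G-dim     : HasDim G s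
      G⊆F       : ∀ v → G v → F v
      F⊆F⊥      : ∀ v → F v → (F ⊥) v
      F⊥⊆F      : ∀ v → (F ⊥) v → F v
      tF⊆G      : ∀ v → F v → G (t v)
      tG≡0      : ∀ v → G v → t v ≈ᵛ 0ᵛ
      rankParity : ∀ h → HasDim (tImage F) h → h ℕ.% 2 ≡ s ℕ.% 2

{-# OPTIONS --safe #-}
module Submission where

open import Defs
open import Level using (_⊔_)
open import Algebra.Bundles using (CommutativeRing)
open import Data.Empty using (⊥)
open import Data.Fin as Fin using (Fin; zero; suc; toℕ; punchIn; punchOut; opposite)
open import Data.Fin.Properties using (toℕ<n; opposite-prop; punchIn-punchOut)
open import Data.Nat as ℕ using (ℕ; zero; suc; z≤n; _%_)
import Data.Nat.Properties as ℕ
open import Data.Product using (Σ-syntax; _×_; _,_; proj₁; proj₂)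
open import Data.Vec.Functional using (insertAt)
open import Data.Vec.Functional.Properties using (insertAt-lookup; insertAt-punchIn)
open import Function using (_∘_)
open import Relation.Binary.PropositionalEquality as ≡ using (_≡_)
open import Relation.Nullary using (¬_; yes; no)
open import Relation.Nullary.Decidable using (decidable-stable; ¬¬-excluded-middle)
open import Relation.Unary using (_⊆_; _≐_)

-- tF lies in G ∩ G^⊥′: it lies in G, and for g = t y ∈ G ⊆ F one has
-- (t x , y) = -(x , t y) = -(x , g) = 0 because F is isotropic.  As G^⊥′ ∩ G ⊆ G,
-- monotonicity of dimension (Steinitz exchange) gives h ≤ l ≤ s.  Since tG = 0, G lies
-- in t(Λ_m ⊗ κ), where the modified pairing { , } is an alternating form (char κ ≠ 2),
-- and G ∩ G^⊥′ is exactly its radical on G.  The radical of an alternating form on an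
-- s-dimensional space has dimension ≡ s (mod 2): split off hyperbolic planes ⟨gᵢ, gⱼ⟩
-- with {gᵢ, gⱼ} ≠ 0 until the form vanishes.

-- κ has no decidable equality, so case distinctions such as "some coefficient is ≉ 0,
-- or all are ≈ 0" are made under double negation; every conclusion drawn this way is a
-- decidable statement about natural numbers, hence stable.
¬¬-pull-Fin : ∀ {p n} {P : Fin n → Set p} → (∀ i → ¬ ¬ P i) → ¬ ¬ (∀ i → P i)
¬¬-pull-Fin {n = zero}  ¬¬P ¬∀P = ¬∀P λ ()
¬¬-pull-Fin {n = suc n} ¬¬P ¬∀P =
  ¬¬P zero λ P₀ → ¬¬-pull-Fin (¬¬P ∘ suc) λ P₊ → ¬∀P λ { zero → P₀ ; (suc i) → P₊ i }

toℕ-opposite+suc : ∀ {k} (i : Fin k) → toℕ (opposite i) ℕ.+ suc (toℕ i) ≡ k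
toℕ-opposite+suc i = ≡.trans (≡.cong (ℕ._+ suc (toℕ i)) (opposite-prop i)) (ℕ.m∸n+n≡m (toℕ<n i))

module LinearAlgebra {c ℓ} (κ : CommutativeRing c ℓ) where
  open CommutativeRing κ hiding (zero)
  open LinAlg κ public
  open import Algebra.Properties.CommutativeSemigroup +-commutativeSemigroup using (interchange)
  open import Algebra.Properties.Ring ring using (-0#≈0#; -1*x≈-x; -‿+-comm; +-inverseˡ-unique)
  open import Algebra.Properties.Semiring.Sum semiring
    using (sum; sum-cong-≋; ∑-distrib-+; *-distribˡ-sum; *-distribʳ-sum; sum-remove; sum-replicate-zero; ∑-permute)
  open import Data.Fin.Permutation using (reverse)
  open import Relation.Binary.Reasoning.Setoid setoid
  open import Algebra.Solver.Ring.NaturalCoefficients.Default commutativeSemiring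
    using (solve; _:=_; _:+_; _:*_)

  ∑≡sum : ∀ {d} (f : Fin d → Carrier) → ∑ f ≡ sum f
  ∑≡sum {zero}  f = ≡.refl
  ∑≡sum {suc d} f = ≡.cong (f zero +_) (∑≡sum (f ∘ suc))

  ∑-cong : ∀ {d} {f g : Fin d → Carrier} → (∀ i → f i ≈ g i) → ∑ f ≈ ∑ g
  ∑-cong {f = f} {g} f≈g rewrite ∑≡sum f | ∑≡sum g = sum-cong-≋ f≈g

  ∑-+ : ∀ {d} (f g : Fin d → Carrier) → ∑ (λ i → f i + g i) ≈ ∑ f + ∑ g
  ∑-+ f g rewrite ∑≡sum (λ i → f i + g i) | ∑≡sum f | ∑≡sum g = ∑-distrib-+ f g

  ∑-*ˡ : ∀ {d} a (f : Fin d → Carrier) → ∑ (λ i → a * f i) ≈ a * ∑ f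
  ∑-*ˡ a f rewrite ∑≡sum (λ i → a * f i) | ∑≡sum f = sym (*-distribˡ-sum a f)

  ∑-*ʳ : ∀ {d} a (f : Fin d → Carrier) → ∑ (λ i → f i * a) ≈ ∑ f * a
  ∑-*ʳ a f rewrite ∑≡sum (λ i → f i * a) | ∑≡sum f = sym (*-distribʳ-sum a f)

  ∑-zero : ∀ {d} {f : Fin d → Carrier} → (∀ i → f i ≈ 0#) → ∑ f ≈ 0#
  ∑-zero {d} {f} f≈0 rewrite ∑≡sum f = trans (sum-cong-≋ f≈0) (sum-replicate-zero d)

  ∑-punchIn : ∀ {d} (f : Fin (suc d) → Carrier) i → ∑ f ≈ f i + ∑ (f ∘ punchIn i)
  ∑-punchIn f i rewrite ∑≡sum f | ∑≡sum (f ∘ punchIn i) = sum-remove f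

  ∑-neg : ∀ {d} (f : Fin d → Carrier) → ∑ (λ i → - f i) ≈ - ∑ f
  ∑-neg {zero}  f = sym -0#≈0#
  ∑-neg {suc d} f = trans (+-congˡ (∑-neg (f ∘ suc))) (-‿+-comm (f zero) (∑ (f ∘ suc)))

  ∑-reverse : ∀ {d} (f : Fin d → Carrier) → ∑ f ≈ ∑ (f ∘ opposite)
  ∑-reverse f rewrite ∑≡sum f | ∑≡sum (f ∘ opposite) = ∑-permute f reverse

  x+[yz]x≈0 : ∀ {y z} → y * z ≈ - 1# → ∀ x → x + (y * z) * x ≈ 0#
  x+[yz]x≈0 yz≈-1 x = trans (+-congˡ (trans (*-congʳ yz≈-1) (-1*x≈-x x))) (-‿inverseʳ x)

  x+[yx]z≈0 : ∀ {y z} → y * z ≈ - 1# → ∀ x → x + (y * x) * z ≈ 0#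
  x+[yx]z≈0 {y} {z} yz≈-1 x = trans (+-congˡ (reorder y x z)) (x+[yz]x≈0 yz≈-1 x)
    where
    reorder : ∀ y x z → (y * x) * z ≈ (y * z) * x
    reorder = solve 3 (λ y x z → (y :* x) :* z := (y :* z) :* x) refl

  Span : ∀ {d k} → (Fin k → Vect d) → Vect d → Set (c ⊔ ℓ)
  Span {k = k} h v = Σ[ coef ∈ (Fin k → Carrier) ] v ≈ᵛ lincomb coef h

  Independent : ∀ {d k} → (Fin k → Vect d) → Set (c ⊔ ℓ)
  Independent h = ∀ coef → lincomb coef h ≈ᵛ 0ᵛ → ∀ i → coef i ≈ 0#

  module _ {d : ℕ} where
    private
      V = Vect d

    lincomb-cong : ∀ {k} {e e′ : Fin k → Carrier} (h : Fin k → V) → (∀ q → e q ≈ e′ q) →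
      lincomb e h ≈ᵛ lincomb e′ h
    lincomb-cong h e≈e′ x = ∑-cong (λ q → *-congʳ (e≈e′ q))

    lincomb-zero : ∀ {k} (h : Fin k → V) → lincomb (λ _ → 0#) h ≈ᵛ 0ᵛ
    lincomb-zero h x = ∑-zero (λ q → zeroˡ (h q x))

    lincomb-+ : ∀ {k} (e e′ : Fin k → Carrier) (h : Fin k → V) →
      lincomb (λ q → e q + e′ q) h ≈ᵛ (lincomb e h +ᵛ lincomb e′ h)
    lincomb-+ e e′ h x =
      trans (∑-cong (λ q → distribʳ (h q x) (e q) (e′ q))) (∑-+ (λ q → e q * h q x) (λ q → e′ q * h q x))

    lincomb-· : ∀ {k} a (e : Fin k → Carrier) (h : Fin k → V) → lincomb (λ q → a * e q) h ≈ᵛ (a · lincomb e h)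
    lincomb-· a e h x = trans (∑-cong (λ q → *-assoc a (e q) (h q x))) (∑-*ˡ a (λ q → e q * h q x))

    lincomb-punchIn : ∀ {k} (e : Fin (suc k) → Carrier) (h : Fin (suc k) → V) p →
      lincomb e h ≈ᵛ ((e p · h p) +ᵛ lincomb (e ∘ punchIn p) (h ∘ punchIn p))
    lincomb-punchIn e h p x = ∑-punchIn (λ q → e q * h q x) p

    lincomb-insertAt : ∀ {k} (e : Fin k → Carrier) (h : Fin (suc k) → V) p a →
      lincomb (insertAt e p a) h ≈ᵛ ((a · h p) +ᵛ lincomb e (h ∘ punchIn p))
    lincomb-insertAt e h p a x = trans (lincomb-punchIn (insertAt e p a) h p x)
      (+-cong (*-congʳ (reflexive (insertAt-lookup e p a)))
              (lincomb-cong (h ∘ punchIn p) (reflexive ∘ insertAt-punchIn e p a) x))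

    lincomb-shear : ∀ {k} (e μ : Fin k → Carrier) (h : Fin k → V) v →
      lincomb e (λ q → h q +ᵛ (μ q · v)) ≈ᵛ (lincomb e h +ᵛ (∑ (λ q → e q * μ q) · v))
    lincomb-shear e μ h v x = begin
      ∑ (λ q → e q * (h q x + μ q * v x))          ≈⟨ ∑-cong (λ q → expand (e q) (h q x) (μ q) (v x)) ⟩
      ∑ (λ q → e q * h q x + (e q * μ q) * v x)    ≈⟨ ∑-+ (λ q → e q * h q x) (λ q → (e q * μ q) * v x) ⟩
      lincomb e h x + ∑ (λ q → (e q * μ q) * v x)  ≈⟨ +-congˡ (∑-*ʳ (v x) (λ q → e q * μ q)) ⟩
      lincomb e h x + ∑ (λ q → e q * μ q) * v x    ∎
      where
      expand : ∀ a b m w → a * (b + m * w) ≈ a * b + (a * m) * w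
      expand = solve 4 (λ a b m w → a :* (b :+ m :* w) := a :* b :+ (a :* m) :* w) refl

    unit : ∀ {k} → Fin (suc k) → Fin (suc k) → Carrier
    unit i = insertAt (λ _ → 0#) i 1#

    lincomb-unit : ∀ {k} (h : Fin (suc k) → V) i → lincomb (unit i) h ≈ᵛ h i
    lincomb-unit h i x = begin
      lincomb (unit i) h x
        ≈⟨ lincomb-insertAt (λ _ → 0#) h i 1# x ⟩
      1# * h i x + lincomb (λ _ → 0#) (h ∘ punchIn i) x
        ≈⟨ +-cong (*-identityˡ (h i x)) (lincomb-zero (h ∘ punchIn i) x) ⟩
      h i x + 0#
        ≈⟨ +-identityʳ (h i x) ⟩
      h i x
        ∎

    subspace-lincomb : ∀ {k} {W : V → Set (c ⊔ ℓ)} → IsSubspace W →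
      (e : Fin k → Carrier) (h : Fin k → V) → (∀ q → W (h q)) → W (lincomb e h)
    subspace-lincomb {zero}  W-sub e h h∈W = IsSubspace.∈-0 W-sub
    subspace-lincomb {suc k} W-sub e h h∈W = IsSubspace.∈-+ W-sub
      (IsSubspace.∈-· W-sub (e zero) (h∈W zero))
      (subspace-lincomb W-sub (e ∘ suc) (h ∘ suc) (h∈W ∘ suc))

    span-minimal : ∀ {k} {W : V → Set (c ⊔ ℓ)} → IsSubspace W →
      (h : Fin k → V) → (∀ q → W (h q)) → Span h ⊆ W
    span-minimal W-sub h h∈W (e , v≈) =
      IsSubspace.∈-resp W-sub (λ x → sym (v≈ x)) (subspace-lincomb W-sub e h h∈W)

    span-isSubspace : ∀ {k} (h : Fin k → V) → IsSubspace (Span h)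
    span-isSubspace h = record
      { ∈-resp = λ { u≈v (e , u≈) → e , λ x → trans (sym (u≈v x)) (u≈ x) }
      ; ∈-0    = (λ _ → 0#) , λ x → sym (lincomb-zero h x)
      ; ∈-+    = λ { (e , u≈) (e′ , v≈) →
                     (λ q → e q + e′ q) , λ x → trans (+-cong (u≈ x) (v≈ x)) (sym (lincomb-+ e e′ h x)) }
      ; ∈-·    = λ { a (e , v≈) → (λ q → a * e q) , λ x → trans (*-congˡ (v≈ x)) (sym (lincomb-· a e h x)) }
      }

    generator∈span : ∀ {k} (h : Fin k → V) i → Span h (h i)
    generator∈span {suc k} h i = unit i , λ x → sym (lincomb-unit h i x)

    span-drop-head : ∀ {j} (gen : Fin (suc j) → V) {v} (v∈ : Span gen v) →
      proj₁ v∈ zero ≈ 0# → Span (gen ∘ suc) v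
    span-drop-head gen (e , v≈) e₀≈0 = e ∘ suc , λ x →
      trans (v≈ x) (trans (+-congʳ (trans (*-congʳ e₀≈0) (zeroˡ _))) (+-identityˡ _))

    span-eliminate-head : ∀ {j} (gen : Fin (suc j) → V) {u v w} (u∈ : Span gen u) (v∈ : Span gen v) →
      w * proj₁ u∈ zero ≈ - 1# → Span (gen ∘ suc) (v +ᵛ ((w * proj₁ v∈ zero) · u))
    span-eliminate-head {j} gen {u} {v} {w} (e , u≈) (f , v≈) we₀≈-1 =
      IsSubspace.∈-resp S (λ x → sym (≈tails x))
        (IsSubspace.∈-+ S (f ∘ suc , λ _ → refl) (IsSubspace.∈-· S μ (e ∘ suc , λ _ → refl)))
      where
      S = span-isSubspace (gen ∘ suc)
      μ = w * f zero
      tail : (Fin (suc j) → Carrier) → V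
      tail c = lincomb (c ∘ suc) (gen ∘ suc)
      collect : ∀ f₀ g₀ F μ e₀ E → (f₀ * g₀ + F) + μ * (e₀ * g₀ + E) ≈ (f₀ + μ * e₀) * g₀ + (F + μ * E)
      collect = solve 6 (λ f₀ g₀ F μ e₀ E →
        (f₀ :* g₀ :+ F) :+ μ :* (e₀ :* g₀ :+ E) := (f₀ :+ μ :* e₀) :* g₀ :+ (F :+ μ :* E)) refl
      ≈tails : (v +ᵛ (μ · u)) ≈ᵛ (tail f +ᵛ (μ · tail e))
      ≈tails x = begin
        v x + μ * u x
          ≈⟨ +-cong (v≈ x) (*-congˡ (u≈ x)) ⟩
        (f zero * gen zero x + tail f x) + μ * (e zero * gen zero x + tail e x)
          ≈⟨ collect _ _ _ μ _ _ ⟩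
        (f zero + μ * e zero) * gen zero x + (tail f x + μ * tail e x)
          ≈⟨ +-congʳ (trans (*-congʳ (x+[yx]z≈0 we₀≈-1 (f zero))) (zeroˡ _)) ⟩
        0# + (tail f x + μ * tail e x)
          ≈⟨ +-identityˡ _ ⟩
        tail f x + μ * tail e x
          ∎

    independent⇒basis : ∀ {k} {h : Fin k → V} → Independent h → IsBasis (Span h) h
    independent⇒basis {h = h} h-indep = record
      { inW = generator∈span h ; indep = h-indep ; spanning = λ _ v∈ → v∈ }

    basis⇒≐span : ∀ {k} {W : V → Set (c ⊔ ℓ)} {h : Fin k → V} → IsSubspace W → IsBasis W h → W ≐ Span h
    basis⇒≐span {h = h} W-sub h-basis =
      (λ {v} → IsBasis.spanning h-basis v) , span-minimal W-sub h (IsBasis.inW h-basis)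

    hasDim-resp-≐ : ∀ {k} {W W′ : V → Set (c ⊔ ℓ)} → W ≐ W′ → HasDim W k → HasDim W′ k
    hasDim-resp-≐ (W⊆W′ , W′⊆W) (h , h-basis) = h , record
      { inW      = W⊆W′ ∘ IsBasis.inW h-basis
      ; indep    = IsBasis.indep h-basis
      ; spanning = λ v → IsBasis.spanning h-basis v ∘ W′⊆W
      }

    independent-insertAt : ∀ {k} (h : Fin (suc k) → V) → Independent h → ∀ p a (e : Fin k → Carrier) →
      ((a · h p) +ᵛ lincomb e (h ∘ punchIn p)) ≈ᵛ 0ᵛ → ∀ q → e q ≈ 0#
    independent-insertAt h h-indep p a e ≈0 q =
      trans (sym (reflexive (insertAt-punchIn e p a q)))
            (h-indep (insertAt e p a) (λ x → trans (lincomb-insertAt e h p a x) (≈0 x)) (punchIn p q))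

    independent-shear : ∀ {k} (h : Fin (suc k) → V) → Independent h → ∀ p (μ : Fin k → Carrier) →
      Independent (λ q → h (punchIn p q) +ᵛ (μ q · h p))
    independent-shear h h-indep p μ e ≈0 = independent-insertAt h h-indep p (∑ (λ q → e q * μ q)) e
      (λ x → trans (+-comm _ _) (trans (sym (lincomb-shear e μ (h ∘ punchIn p) (h p) x)) (≈0 x)))

    independent⇒≉0 : ∀ {k} (h : Fin k → V) → ¬ (1# ≈ 0#) → Independent h → ∀ i → ¬ (h i ≈ᵛ 0ᵛ)
    independent⇒≉0 {suc k} h 1≉0 h-indep i hᵢ≈0 =
      1≉0 (trans (sym (reflexive (insertAt-lookup (λ _ → 0#) i 1#)))
                 (h-indep (unit i) (λ x → trans (lincomb-unit h i x) (hᵢ≈0 x)) i))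

    record IsLinearForm (φ : V → Carrier) : Set (c ⊔ ℓ) where
      field
        resp   : ∀ {u v} → u ≈ᵛ v → φ u ≈ φ v
        +-homo : ∀ u v → φ (u +ᵛ v) ≈ φ u + φ v
        ·-homo : ∀ a v → φ (a · v) ≈ a * φ v

      0-homo : φ 0ᵛ ≈ 0#
      0-homo = begin
        φ 0ᵛ        ≈⟨ resp (λ _ → sym (zeroˡ 0#)) ⟩
        φ (0# · 0ᵛ) ≈⟨ ·-homo 0# 0ᵛ ⟩
        0# * φ 0ᵛ   ≈⟨ zeroˡ _ ⟩
        0#          ∎

      +·-homo : ∀ v a w → φ (v +ᵛ (a · w)) ≈ φ v + a * φ w
      +·-homo v a w = trans (+-homo v (a · w)) (+-congˡ (·-homo a w))

      lincomb-homo : ∀ {k} (e : Fin k → Carrier) (h : Fin k → V) → φ (lincomb e h) ≈ ∑ (λ q → e q * φ (h q))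
      lincomb-homo {zero}  e h = 0-homo
      lincomb-homo {suc k} e h = trans (+-homo (e zero · h zero) (lincomb (e ∘ suc) (h ∘ suc)))
        (+-cong (·-homo (e zero) (h zero)) (lincomb-homo (e ∘ suc) (h ∘ suc)))

      vanishes-on-span : ∀ {k} {h : Fin k → V} → (∀ q → φ (h q) ≈ 0#) → ∀ {v} → Span h v → φ v ≈ 0#
      vanishes-on-span {h = h} φh≈0 {v} (e , v≈) = begin
        φ v                          ≈⟨ resp v≈ ⟩
        φ (lincomb e h)              ≈⟨ lincomb-homo e h ⟩
        ∑ (λ q → e q * φ (h q))      ≈⟨ ∑-zero (λ q → trans (*-congˡ (φh≈0 q)) (zeroʳ (e q))) ⟩
        0#                           ∎

    coordinate-isLinearForm : ∀ x → IsLinearForm (λ v → v x)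
    coordinate-isLinearForm x = record { resp = λ u≈v → u≈v x ; +-homo = λ _ _ → refl ; ·-homo = λ _ _ → refl }

    +-isLinearForm : ∀ {φ ψ} → IsLinearForm φ → IsLinearForm ψ → IsLinearForm (λ v → φ v + ψ v)
    +-isLinearForm φ-lin ψ-lin = record
      { resp   = λ u≈v → +-cong (resp φ-lin u≈v) (resp ψ-lin u≈v)
      ; +-homo = λ u v → trans (+-cong (+-homo φ-lin u v) (+-homo ψ-lin u v)) (interchange _ _ _ _)
      ; ·-homo = λ a v → trans (+-cong (·-homo φ-lin a v) (·-homo ψ-lin a v)) (sym (distribˡ a _ _))
      }
      where open IsLinearForm

    scale-isLinearForm : ∀ {φ} y z → IsLinearForm φ → IsLinearForm (λ v → (y * φ v) * z)
    scale-isLinearForm {φ} y z φ-lin = record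
      { resp   = λ u≈v → *-congʳ (*-congˡ (resp φ-lin u≈v))
      ; +-homo = λ u v → trans (*-congʳ (*-congˡ (+-homo φ-lin u v))) (spread y (φ u) (φ v) z)
      ; ·-homo = λ a v → trans (*-congʳ (*-congˡ (·-homo φ-lin a v))) (pull y a (φ v) z)
      }
      where
      open IsLinearForm
      spread : ∀ y a b z → (y * (a + b)) * z ≈ (y * a) * z + (y * b) * z
      spread = solve 4 (λ y a b z → (y :* (a :+ b)) :* z := (y :* a) :* z :+ (y :* b) :* z) refl
      pull : ∀ y a b z → (y * (a * b)) * z ≈ a * ((y * b) * z)
      pull = solve 4 (λ y a b z → (y :* (a :* b)) :* z := a :* ((y :* b) :* z)) refl

    lincomb-linearMap : ∀ {P : V → V} → (∀ x → IsLinearForm (λ v → P v x)) →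
      ∀ {k} (e : Fin k → Carrier) (h : Fin k → V) → P (lincomb e h) ≈ᵛ lincomb e (P ∘ h)
    lincomb-linearMap P-linear e h x = IsLinearForm.lincomb-homo (P-linear x) e h

    record IsAlternatingForm (B : V → V → Carrier) : Set (c ⊔ ℓ) where
      field
        linearˡ     : ∀ w → IsLinearForm (λ v → B v w)
        linearʳ     : ∀ v → IsLinearForm (B v)
        alternating : ∀ v → B v v ≈ 0#

      skew : ∀ u v → B u v ≈ - B v u
      skew u v = +-inverseˡ-unique (B u v) (B v u) (begin
        B u v + B v u
          ≈⟨ +-cong (sym (+-identityˡ _)) (sym (+-identityʳ _)) ⟩
        (0# + B u v) + (B v u + 0#)
          ≈⟨ +-cong (+-congʳ (sym (alternating u))) (+-congˡ (sym (alternating v))) ⟩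
        (B u u + B u v) + (B v u + B v v)
          ≈⟨ +-cong (sym (+-homo (linearʳ u) u v)) (sym (+-homo (linearʳ v) u v)) ⟩
        B u (u +ᵛ v) + B v (u +ᵛ v)
          ≈⟨ sym (+-homo (linearˡ (u +ᵛ v)) u v) ⟩
        B (u +ᵛ v) (u +ᵛ v)
          ≈⟨ alternating (u +ᵛ v) ⟩
        0#
          ∎)
        where open IsLinearForm

    Radical : (V → V → Carrier) → (V → Set (c ⊔ ℓ)) → V → Set (c ⊔ ℓ)
    Radical B W v = W v × (∀ {w} → W w → B v w ≈ 0#)

    radical-resp-≐ : ∀ {B} {W W′ : V → Set (c ⊔ ℓ)} → W ≐ W′ → Radical B W ≐ Radical B W′
    radical-resp-≐ (W⊆W′ , W′⊆W) =
      (λ { (v∈W , v⊥W) → W⊆W′ v∈W , v⊥W ∘ W′⊆W }) ,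
      (λ { (v∈W′ , v⊥W′) → W′⊆W v∈W′ , v⊥W′ ∘ W⊆W′ })

module FieldLinearAlgebra {c ℓ} (κ : CommutativeRing c ℓ) (κ-field : IsField κ) where
  open CommutativeRing κ hiding (zero)
  open LinearAlgebra κ
  open import Algebra.Properties.Ring ring using (-‿distribˡ-*; -0#≈0#)
  open import Relation.Binary.Reasoning.Setoid setoid
  open import Algebra.Solver.Ring.NaturalCoefficients.Default commutativeSemiring
    using (solve; _:=_; _:+_; _:*_)

  private
    1≉0 : ¬ (1# ≈ 0#)
    1≉0 = proj₁ κ-field

  negated-inverse : ∀ {a} → ¬ (a ≈ 0#) → Σ[ w ∈ Carrier ] w * a ≈ - 1#
  negated-inverse {a} a≉0 with proj₂ κ-field a a≉0
  ... | u , au≈1 = - u , trans (sym (-‿distribˡ-* u a)) (-‿cong (trans (*-comm u a) au≈1))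

  x≈-x⇒x≈0 : CharNot2 κ → ∀ {x} → x ≈ - x → x ≈ 0#
  x≈-x⇒x≈0 2≉0 {x} x≈-x with proj₂ κ-field (1# + 1#) 2≉0
  ... | u , 2u≈1 = begin
    x                    ≈⟨ *-identityˡ x ⟨
    1# * x               ≈⟨ *-congʳ (trans (*-comm u _) 2u≈1) ⟨
    (u * (1# + 1#)) * x  ≈⟨ *-assoc u _ x ⟩
    u * ((1# + 1#) * x)  ≈⟨ *-congˡ (trans (distribʳ x 1# 1#) (+-cong (*-identityˡ x) (*-identityˡ x))) ⟩
    u * (x + x)          ≈⟨ *-congˡ (trans (+-congˡ x≈-x) (-‿inverseʳ x)) ⟩
    u * 0#               ≈⟨ zeroʳ u ⟩
    0#                   ∎

  module _ {d : ℕ} where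
    private
      V = Vect d

    -- If some b p has a nonzero coefficient on gen zero, use it to eliminate gen zero from
    -- the other b's (which stay independent); otherwise simply drop gen zero.
    steinitz : ∀ {j k} (gen : Fin j → V) (b : Fin k → V) → Independent b → (∀ p → Span gen (b p)) →
      ¬ (j ℕ.< k)
    steinitz {zero}  {suc k} gen b b-indep b∈ _ = independent⇒≉0 b 1≉0 b-indep zero (proj₂ (b∈ zero))
    steinitz {suc j} {suc k} gen b b-indep b∈ j<k =
      ¬¬-excluded-middle {A = Σ[ p ∈ Fin (suc k) ] ¬ (lead p ≈ 0#)} λ where
        (yes (p , leadₚ≉0)) → let (w , w*leadₚ≈-1) = negated-inverse leadₚ≉0 in
          steinitz (gen ∘ suc) (λ q → b (punchIn p q) +ᵛ ((w * lead (punchIn p q)) · b p))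
            (independent-shear b b-indep p (λ q → w * lead (punchIn p q)))
            (λ q → span-eliminate-head gen (b∈ p) (b∈ (punchIn p q)) w*leadₚ≈-1)
            (ℕ.s<s⁻¹ j<k)
        (no ∄) → ¬¬-pull-Fin (λ p leadₚ≉0 → ∄ (p , leadₚ≉0)) λ lead≈0 →
          steinitz (gen ∘ suc) b b-indep (λ p → span-drop-head gen (b∈ p) (lead≈0 p))
            (ℕ.<-trans (ℕ.n<1+n j) j<k)
      where
      lead : Fin (suc k) → Carrier
      lead p = proj₁ (b∈ p) zero

    independent-in-span⇒≤ : ∀ {j k} {gen : Fin j → V} {b : Fin k → V} →
      Independent b → (∀ p → Span gen (b p)) → k ℕ.≤ j
    independent-in-span⇒≤ b-indep b∈ = ℕ.≮⇒≥ (steinitz _ _ b-indep b∈)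

    dim-mono : ∀ {j k} {U W : V → Set (c ⊔ ℓ)} → U ⊆ W → HasDim U k → HasDim W j → k ℕ.≤ j
    dim-mono U⊆W (b , b-basis) (gen , gen-basis) = independent-in-span⇒≤ (IsBasis.indep b-basis)
      (λ p → IsBasis.spanning gen-basis (b p) (U⊆W (IsBasis.inW b-basis p)))

    -- With a = B gᵢ gⱼ ≉ 0, proj is the projection along the hyperbolic plane ⟨gᵢ , gⱼ⟩ onto its
    -- B-orthogonal (w = -a⁻¹, w′ = a⁻¹); the projections g′ of the other generators span a
    -- complement of the plane in span g.
    module HyperbolicPair {B : V → V → Carrier} (B-alt : IsAlternatingForm B)
      {s} (g : Fin (suc (suc s)) → V) (g-indep : Independent g) (i : Fin (suc (suc s))) (j : Fin (suc s))
      (Bgᵢgⱼ≉0 : ¬ (B (g i) (g (punchIn i j)) ≈ 0#)) where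
      open IsAlternatingForm B-alt
      open IsLinearForm using (resp; +·-homo)

      gᵢ gⱼ : V
      gᵢ = g i
      gⱼ = g (punchIn i j)

      ι : Fin s → Fin (suc (suc s))
      ι k = punchIn i (punchIn j k)

      Bgⱼgᵢ≉0 : ¬ (B gⱼ gᵢ ≈ 0#)
      Bgⱼgᵢ≉0 Bgⱼgᵢ≈0 = Bgᵢgⱼ≉0 (trans (skew gᵢ gⱼ) (trans (-‿cong Bgⱼgᵢ≈0) -0#≈0#))

      w w′ : Carrier
      w  = proj₁ (negated-inverse Bgᵢgⱼ≉0)
      w′ = proj₁ (negated-inverse Bgⱼgᵢ≉0)

      proj : V → V
      proj v = (v +ᵛ ((w * B v gⱼ) · gᵢ)) +ᵛ ((w′ * B v gᵢ) · gⱼ)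

      g′ : Fin s → V
      g′ = proj ∘ g ∘ ι

      proj-linear : ∀ x → IsLinearForm (λ v → proj v x)
      proj-linear x = +-isLinearForm (+-isLinearForm (coordinate-isLinearForm x)
                                                     (scale-isLinearForm w (gᵢ x) (linearˡ gⱼ)))
                                     (scale-isLinearForm w′ (gⱼ x) (linearˡ gᵢ))

      private
        w-inverse : w * B gᵢ gⱼ ≈ - 1#
        w-inverse = proj₂ (negated-inverse Bgᵢgⱼ≉0)

        w′-inverse : w′ * B gⱼ gᵢ ≈ - 1#
        w′-inverse = proj₂ (negated-inverse Bgⱼgᵢ≉0)

        killed : ∀ {b} y z → b ≈ 0# → (y * b) * z ≈ 0#
        killed y z b≈0 = trans (*-congʳ (trans (*-congˡ b≈0) (zeroʳ y))) (zeroˡ z)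

      proj-gᵢ : proj gᵢ ≈ᵛ 0ᵛ
      proj-gᵢ x = trans (+-cong (x+[yz]x≈0 w-inverse (gᵢ x)) (killed w′ (gⱼ x) (alternating gᵢ)))
                        (+-identityʳ 0#)

      proj-gⱼ : proj gⱼ ≈ᵛ 0ᵛ
      proj-gⱼ x = trans (+-congʳ (trans (+-congˡ (killed w (gᵢ x) (alternating gⱼ))) (+-identityʳ (gⱼ x))))
                        (x+[yz]x≈0 w′-inverse (gⱼ x))

      B-projˡ : ∀ v z → B (proj v) z ≈ (B v z + (w * B v gⱼ) * B gᵢ z) + (w′ * B v gᵢ) * B gⱼ z
      B-projˡ v z = trans (+·-homo (linearˡ z) _ _ _) (+-congʳ (+·-homo (linearˡ z) _ _ _))

      B-projʳ : ∀ y v → B y (proj v) ≈ (B y v + (w * B v gⱼ) * B y gᵢ) + (w′ * B v gᵢ) * B y gⱼ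
      B-projʳ y v = trans (+·-homo (linearʳ y) _ _ _) (+-congʳ (+·-homo (linearʳ y) _ _ _))

      proj-⊥gᵢ : ∀ v → B (proj v) gᵢ ≈ 0#
      proj-⊥gᵢ v = begin
        B (proj v) gᵢ
          ≈⟨ B-projˡ v gᵢ ⟩
        (B v gᵢ + (w * B v gⱼ) * B gᵢ gᵢ) + (w′ * B v gᵢ) * B gⱼ gᵢ
          ≈⟨ +-congʳ (+-congˡ (*-congˡ (alternating gᵢ))) ⟩
        (B v gᵢ + (w * B v gⱼ) * 0#) + (w′ * B v gᵢ) * B gⱼ gᵢ
          ≈⟨ +-congʳ (trans (+-congˡ (zeroʳ _)) (+-identityʳ _)) ⟩
        B v gᵢ + (w′ * B v gᵢ) * B gⱼ gᵢ
          ≈⟨ x+[yx]z≈0 w′-inverse (B v gᵢ) ⟩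
        0#
          ∎

      proj-⊥gⱼ : ∀ v → B (proj v) gⱼ ≈ 0#
      proj-⊥gⱼ v = begin
        B (proj v) gⱼ
          ≈⟨ B-projˡ v gⱼ ⟩
        (B v gⱼ + (w * B v gⱼ) * B gᵢ gⱼ) + (w′ * B v gᵢ) * B gⱼ gⱼ
          ≈⟨ +-congˡ (*-congˡ (alternating gⱼ)) ⟩
        (B v gⱼ + (w * B v gⱼ) * B gᵢ gⱼ) + (w′ * B v gᵢ) * 0#
          ≈⟨ trans (+-congˡ (zeroʳ _)) (+-identityʳ _) ⟩
        B v gⱼ + (w * B v gⱼ) * B gᵢ gⱼ
          ≈⟨ x+[yx]z≈0 w-inverse (B v gⱼ) ⟩
        0#
          ∎

      proj-fix : ∀ {v} → B v gᵢ ≈ 0# → B v gⱼ ≈ 0# → proj v ≈ᵛ v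
      proj-fix {v} Bvgᵢ≈0 Bvgⱼ≈0 x =
        trans (+-cong (+-congˡ (killed w (gᵢ x) Bvgⱼ≈0)) (killed w′ (gⱼ x) Bvgᵢ≈0))
              (trans (+-identityʳ _) (+-identityʳ (v x)))

      B-proj-fix : ∀ {y} → B y gᵢ ≈ 0# → B y gⱼ ≈ 0# → ∀ v → B y (proj v) ≈ B y v
      B-proj-fix {y} Bygᵢ≈0 Bygⱼ≈0 v = begin
        B y (proj v)
          ≈⟨ B-projʳ y v ⟩
        (B y v + (w * B v gⱼ) * B y gᵢ) + (w′ * B v gᵢ) * B y gⱼ
          ≈⟨ +-cong (+-congˡ (*-congˡ Bygᵢ≈0)) (*-congˡ Bygⱼ≈0) ⟩
        (B y v + (w * B v gⱼ) * 0#) + (w′ * B v gᵢ) * 0#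
          ≈⟨ +-cong (+-congˡ (zeroʳ _)) (zeroʳ _) ⟩
        (B y v + 0#) + 0#
          ≈⟨ trans (+-identityʳ _) (+-identityʳ _) ⟩
        B y v
          ∎

      proj-span : ∀ {v} → Span g v → Span g′ (proj v)
      proj-span {v} (e , v≈) = e ∘ ι , λ x → begin
        proj v x
          ≈⟨ resp (proj-linear x) v≈ ⟩
        proj (lincomb e g) x
          ≈⟨ lincomb-linearMap proj-linear e g x ⟩
        lincomb e (proj ∘ g) x
          ≈⟨ lincomb-punchIn e (proj ∘ g) i x ⟩
        e i * proj gᵢ x + lincomb (e ∘ punchIn i) (proj ∘ g ∘ punchIn i) x
          ≈⟨ +-cong (*-congˡ (proj-gᵢ x)) (lincomb-punchIn (e ∘ punchIn i) (proj ∘ g ∘ punchIn i) j x) ⟩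
        e i * 0# + (e (punchIn i j) * proj gⱼ x + lincomb (e ∘ ι) g′ x)
          ≈⟨ +-cong (zeroʳ (e i)) (+-congʳ (trans (*-congˡ (proj-gⱼ x)) (zeroʳ _))) ⟩
        0# + (0# + lincomb (e ∘ ι) g′ x)
          ≈⟨ trans (+-identityˡ _) (+-identityˡ _) ⟩
        lincomb (e ∘ ι) g′ x
          ∎

      span-g′⊆span-g : Span g′ ⊆ Span g
      span-g′⊆span-g = span-minimal S g′ (λ k → proj∈ (generator∈span g (ι k)))
        where
        S = span-isSubspace g
        proj∈ : ∀ {v} → Span g v → Span g (proj v)
        proj∈ v∈ = IsSubspace.∈-+ S (IsSubspace.∈-+ S v∈ (IsSubspace.∈-· S _ (generator∈span g i)))
                                    (IsSubspace.∈-· S _ (generator∈span g (punchIn i j)))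

      g′-independent : Independent g′
      g′-independent e g′e≈0 k = begin
        e k
          ≡⟨ insertAt-punchIn e j β k ⟨
        insertAt e j β (punchIn j k)
          ≈⟨ independent-insertAt g g-indep i α (insertAt e j β) g≈0 (punchIn j k) ⟩
        0#
          ∎
        where
        y = lincomb e (g ∘ ι)
        α = w * B y gⱼ
        β = w′ * B y gᵢ
        rotate : ∀ a b c → a + (b + c) ≈ (c + a) + b
        rotate = solve 3 (λ a b c → a :+ (b :+ c) := (c :+ a) :+ b) refl
        g≈0 : ((α · gᵢ) +ᵛ lincomb (insertAt e j β) (g ∘ punchIn i)) ≈ᵛ 0ᵛ
        g≈0 x = begin
          α * gᵢ x + lincomb (insertAt e j β) (g ∘ punchIn i) x
            ≈⟨ +-congˡ (lincomb-insertAt e (g ∘ punchIn i) j β x) ⟩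
          α * gᵢ x + (β * gⱼ x + y x)
            ≈⟨ rotate _ _ _ ⟩
          proj y x
            ≈⟨ lincomb-linearMap proj-linear e (g ∘ ι) x ⟩
          lincomb e g′ x
            ≈⟨ g′e≈0 x ⟩
          0#
            ∎

      radical-≐ : Radical B (Span g) ≐ Radical B (Span g′)
      radical-≐ = to , from
        where
        to : Radical B (Span g) ⊆ Radical B (Span g′)
        to (v∈ , v⊥) = IsSubspace.∈-resp (span-isSubspace g′)
                        (proj-fix (v⊥ (generator∈span g i)) (v⊥ (generator∈span g (punchIn i j))))
                        (proj-span v∈)
                    , v⊥ ∘ span-g′⊆span-g
        from : Radical B (Span g′) ⊆ Radical B (Span g)
        from {v} (v∈′ , v⊥′) = span-g′⊆span-g v∈′ , λ {u} u∈ →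
          trans (sym (B-proj-fix (⊥g (proj-⊥gᵢ ∘ g ∘ ι)) (⊥g (proj-⊥gⱼ ∘ g ∘ ι)) u))
                (v⊥′ (proj-span u∈))
          where
          ⊥g : ∀ {z} → (∀ k → B (g′ k) z ≈ 0#) → B v z ≈ 0#
          ⊥g {z} g′⊥z = IsLinearForm.vanishes-on-span (linearˡ z) g′⊥z v∈′

    module _ {B : V → V → Carrier} (B-alt : IsAlternatingForm B) where
      open IsAlternatingForm B-alt

      isotropic⇒radical-dim : ∀ {s l} {g : Fin s → V} → Independent g → (∀ i j → B (g i) (g j) ≈ 0#) →
        HasDim (Radical B (Span g)) l → l ≡ s
      isotropic⇒radical-dim {g = g} g-indep g⊥g rad-dim =
        ℕ.≤-antisym (dim-mono proj₁ rad-dim span-dim) (dim-mono span⊆radical span-dim rad-dim)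
        where
        span-dim = g , independent⇒basis g-indep
        span⊆radical : Span g ⊆ Radical B (Span g)
        span⊆radical {v} v∈ = v∈ , IsLinearForm.vanishes-on-span (linearʳ v)
          (λ j → IsLinearForm.vanishes-on-span (linearˡ (g j)) (λ i → g⊥g i j) v∈)

      mutual
        rank-parity-¬¬ : ∀ {s l} (g : Fin s → V) → Independent g → HasDim (Radical B (Span g)) l →
          ¬ ¬ (l % 2 ≡ s % 2)
        rank-parity-¬¬ {s} g g-indep rad-dim ¬≡ =
          ¬¬-excluded-middle {A = Σ[ i ∈ Fin s ] Σ[ j ∈ Fin s ] ¬ (B (g i) (g j) ≈ 0#)} λ where
            (yes (i , j , Bgᵢgⱼ≉0)) → split-off-pair g g-indep rad-dim i j Bgᵢgⱼ≉0 ¬≡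
            (no ∄) → ¬¬-pull-Fin (λ i → ¬¬-pull-Fin λ j Bgᵢgⱼ≉0 → ∄ (i , j , Bgᵢgⱼ≉0)) λ g⊥g →
              ¬≡ (≡.cong (_% 2) (isotropic⇒radical-dim g-indep g⊥g rad-dim))

        -- In the recursive call, (2 + s) % 2 reduces to s % 2.
        split-off-pair : ∀ {s l} (g : Fin s → V) → Independent g → HasDim (Radical B (Span g)) l →
          ∀ i j → ¬ (B (g i) (g j) ≈ 0#) → ¬ ¬ (l % 2 ≡ s % 2)
        split-off-pair {suc zero} g _ _ zero zero Bg₀g₀≉0 _ = Bg₀g₀≉0 (alternating (g zero))
        split-off-pair {suc (suc s)} g g-indep rad-dim i j Bgᵢgⱼ≉0 with i Fin.≟ j
        ... | yes ≡.refl = λ _ → Bgᵢgⱼ≉0 (alternating (g i))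
        ... | no i≢j = rank-parity-¬¬ g′ g′-independent (hasDim-resp-≐ radical-≐ rad-dim)
          where
          open HyperbolicPair B-alt g g-indep i (punchOut i≢j)
            (≡.subst (λ j → ¬ (B (g i) (g j) ≈ 0#)) (≡.sym (punchIn-punchOut i≢j)) Bgᵢgⱼ≉0)

      rank-parity : ∀ {s l} {W : V → Set (c ⊔ ℓ)} → IsSubspace W → HasDim W s → HasDim (Radical B W) l →
        l % 2 ≡ s % 2
      rank-parity {s} {l} W-sub (g , g-basis) rad-dim = decidable-stable (l % 2 ℕ.≟ s % 2)
        (rank-parity-¬¬ g (IsBasis.indep g-basis)
          (hasDim-resp-≐ (radical-resp-≐ (basis⇒≐span W-sub g-basis)) rad-dim))

module SpecialFiber {c ℓ} (κ : CommutativeRing c ℓ) (m : ℕ) where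
  open CommutativeRing κ hiding (zero)
  open Lattice κ m
  open LinearAlgebra κ using (∑-cong; ∑-+; ∑-*ˡ; ∑-neg; ∑-reverse; IsLinearForm; IsAlternatingForm; Radical)
  open import Algebra.Properties.Ring ring using (-0#≈0#; -‿involutive; -‿distribˡ-*; -‿distribʳ-*)
  open import Relation.Binary.Reasoning.Setoid setoid
  open import Algebra.Solver.Ring.NaturalCoefficients.Default commutativeSemiring
    using (solve; _:=_; _:+_; _:*_)
  open import Data.Bool using (true; false; not; if_then_else_)
  open import Data.Empty using (⊥-elim)
  open import Data.Fin using (_↑ˡ_; _↑ʳ_; splitAt)
  open import Data.Fin.Properties
    using (opposite-involutive; splitAt-↑ˡ; splitAt-↑ʳ; splitAt⁻¹-↑ˡ; splitAt⁻¹-↑ʳ)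
  open import Data.Sum using (inj₁; inj₂)
  open import Data.Vec.Functional using (_++_)
  open import Data.Vec.Functional.Properties using (lookup-++ˡ)
  open import Relation.Nullary.Reflects using (ofʸ; ofⁿ)

  cf-t : ∀ v i → cf (t v) i ≡ 0#
  cf-t v i rewrite splitAt-↑ˡ n i n = ≡.refl

  cπf-t : ∀ v i → cπf (t v) i ≡ cf v i
  cπf-t v i rewrite splitAt-↑ʳ n n i = ≡.refl

  ≈ᵛ-from-halves : ∀ {u v : Λκ} → (∀ i → cf u i ≈ cf v i) → (∀ i → cπf u i ≈ cπf v i) → u ≈ᵛ v
  ≈ᵛ-from-halves {u} {v} cf≈ cπf≈ j with splitAt n j in eq
  ... | inj₁ i = ≡.subst (λ j → u j ≈ v j) (splitAt⁻¹-↑ˡ eq) (cf≈ i)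
  ... | inj₂ i = ≡.subst (λ j → u j ≈ v j) (splitAt⁻¹-↑ʳ eq) (cπf≈ i)

  ker-t⊆tΛ : ∀ {v} → t v ≈ᵛ 0ᵛ → tΛ v
  ker-t⊆tΛ {v} tv≈0 = preimage , ≈ᵛ-from-halves
    (λ i → begin
      cf v i                ≡⟨ cπf-t v i ⟨
      cπf (t v) i           ≈⟨ tv≈0 (n ↑ʳ i) ⟩
      0#                    ≡⟨ cf-t preimage i ⟨
      cf (t preimage) i     ∎)
    (λ i → begin
      cπf v i               ≡⟨ lookup-++ˡ (cπf v) 0ᵛ i ⟨
      cf preimage i         ≡⟨ cπf-t preimage i ⟨
      cπf (t preimage) i    ∎)
    where
    preimage = cπf v ++ 0ᵛ

  opposite-<ᵇ : ∀ (i : Fin n) → (toℕ (opposite i) ℕ.<ᵇ m) ≡ not (toℕ i ℕ.<ᵇ m)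
  opposite-<ᵇ i
    with toℕ i ℕ.<ᵇ m | ℕ.<ᵇ-reflects-< (toℕ i) m
       | toℕ (opposite i) ℕ.<ᵇ m | ℕ.<ᵇ-reflects-< (toℕ (opposite i)) m
  ... | true  | ofʸ i<m | true  | ofʸ i′<m = ⊥-elim (ℕ.<-irrefl ≡.refl
    (≡.subst (ℕ._< n) (toℕ-opposite+suc i) (ℕ.+-mono-≤ i′<m i<m)))
  ... | true  | _       | false | _        = ≡.refl
  ... | false | _       | true  | _        = ≡.refl
  ... | false | ofⁿ i≮m | false | ofⁿ i′≮m = ⊥-elim (ℕ.<-irrefl ≡.refl
    (≡.subst (n ℕ.<_) (toℕ-opposite+suc i) (ℕ.+-mono-≤-< (ℕ.≮⇒≥ i′≮m) (ℕ.s≤s (ℕ.≮⇒≥ i≮m)))))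

  ε-opposite : ∀ i → ε (opposite i) ≈ - ε i
  ε-opposite i =
    ≡.subst (λ b → (if b then 1# else - 1#) ≈ - ε i) (≡.sym (opposite-<ᵇ i)) (sign-not (toℕ i ℕ.<ᵇ m))
    where
    sign-not : ∀ b → (if not b then 1# else - 1#) ≈ - (if b then 1# else - 1#)
    sign-not true  = refl
    sign-not false = sym (-‿involutive 1#)

  ⟪⟫-congˡ : ∀ {x x′} y → x ≈ᵛ x′ → ⟪ x , y ⟫ ≈ ⟪ x′ , y ⟫
  ⟪⟫-congˡ y x≈x′ = ∑-cong λ i →
    *-congˡ (+-cong (*-congʳ (x≈x′ (n ↑ʳ i))) (-‿cong (*-congʳ (x≈x′ (i ↑ˡ n)))))

  ⟪⟫-congʳ : ∀ x {y y′} → y ≈ᵛ y′ → ⟪ x , y ⟫ ≈ ⟪ x , y′ ⟫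
  ⟪⟫-congʳ x y≈y′ = ∑-cong λ i →
    *-congˡ (+-cong (*-congˡ (y≈y′ (opposite i ↑ˡ n))) (-‿cong (*-congˡ (y≈y′ (n ↑ʳ opposite i)))))

  private
    x-0y≈x : ∀ x y → x - 0# * y ≈ x
    x-0y≈x x y = trans (+-congˡ (trans (-‿cong (zeroˡ y)) -0#≈0#)) (+-identityʳ x)

  ⟪tx,y⟫≈-⟪x,ty⟫ : ∀ x y → ⟪ t x , y ⟫ ≈ - ⟪ x , t y ⟫
  ⟪tx,y⟫≈-⟪x,ty⟫ x y = trans (∑-cong term) (∑-neg {n} _)
    where
    term : ∀ i → ε i * (cπf (t x) i * cf y (opposite i) - cf (t x) i * cπf y (opposite i))
               ≈ - (ε i * (cπf x i * cf (t y) (opposite i) - cf x i * cπf (t y) (opposite i)))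
    term i = let o = opposite i in begin
      ε i * (cπf (t x) i * cf y o - cf (t x) i * cπf y o)
        ≈⟨ *-congˡ (+-cong (*-congʳ (reflexive (cπf-t x i))) (-‿cong (*-congʳ (reflexive (cf-t x i))))) ⟩
      ε i * (cf x i * cf y o - 0# * cπf y o)
        ≈⟨ *-congˡ (x-0y≈x _ _) ⟩
      ε i * (cf x i * cf y o)
        ≈⟨ -‿involutive _ ⟨
      - - (ε i * (cf x i * cf y o))
        ≈⟨ -‿cong (-‿distribʳ-* (ε i) _) ⟩
      - (ε i * - (cf x i * cf y o))
        ≈⟨ -‿cong (*-congˡ (trans (+-congʳ (zeroʳ (cπf x i))) (+-identityˡ _))) ⟨
      - (ε i * (cπf x i * 0# - cf x i * cf y o))
        ≈⟨ -‿cong (*-congˡ (+-cong (*-congˡ (reflexive (cf-t y o))) (-‿cong (*-congˡ (reflexive (cπf-t y o)))))) ⟨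
      - (ε i * (cπf x i * cf (t y) o - cf x i * cπf (t y) o))
        ∎

  -- The paper's {t x , t y} = (t x , y), extended to all of Λκ: it only reads πf-coordinates,
  -- and the πf-coordinates of t x are the f-coordinates of x.
  ⟦_,_⟧ : Λκ → Λκ → Carrier
  ⟦ w , v ⟧ = ∑ (λ i → ε i * (cπf w i * cπf v (opposite i)))

  ⟪w,y⟫≈⟦w,ty⟧ : ∀ {w} → t w ≈ᵛ 0ᵛ → ∀ y → ⟪ w , y ⟫ ≈ ⟦ w , t y ⟧
  ⟪w,y⟫≈⟦w,ty⟧ {w} tw≈0 y = ∑-cong λ i → let o = opposite i in *-congˡ (begin
    cπf w i * cf y o - cf w i * cπf y o
      ≈⟨ +-congˡ (-‿cong (*-congʳ (trans (reflexive (≡.sym (cπf-t w i))) (tw≈0 (n ↑ʳ i))))) ⟩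
    cπf w i * cf y o - 0# * cπf y o
      ≈⟨ x-0y≈x _ _ ⟩
    cπf w i * cf y o
      ≡⟨ ≡.cong (cπf w i *_) (cπf-t y o) ⟨
    cπf w i * cπf (t y) o
      ∎)

  ⟦⟧-linearˡ : ∀ v → IsLinearForm (λ w → ⟦ w , v ⟧)
  ⟦⟧-linearˡ v = record
    { resp   = λ w≈w′ → ∑-cong λ i → *-congˡ (*-congʳ (w≈w′ (n ↑ʳ i)))
    ; +-homo = λ u w → trans (∑-cong λ i → spread (ε i) (cπf u i) (cπf w i) (cπf v (opposite i))) (∑-+ {n} _ _)
    ; ·-homo = λ a w → trans (∑-cong λ i → pull (ε i) a (cπf w i) (cπf v (opposite i))) (∑-*ˡ {n} a _)
    }
    where
    spread : ∀ e a b z → e * ((a + b) * z) ≈ e * (a * z) + e * (b * z)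
    spread = solve 4 (λ e a b z → e :* ((a :+ b) :* z) := e :* (a :* z) :+ e :* (b :* z)) refl
    pull : ∀ e a b z → e * ((a * b) * z) ≈ a * (e * (b * z))
    pull = solve 4 (λ e a b z → e :* ((a :* b) :* z) := a :* (e :* (b :* z))) refl

  ⟦⟧-linearʳ : ∀ w → IsLinearForm (λ v → ⟦ w , v ⟧)
  ⟦⟧-linearʳ w = record
    { resp   = λ v≈v′ → ∑-cong λ i → *-congˡ (*-congˡ (v≈v′ (n ↑ʳ opposite i)))
    ; +-homo = λ u v → trans (∑-cong λ i → spread (ε i) (cπf w i) (cπf u (opposite i)) (cπf v (opposite i)))
                             (∑-+ {n} _ _)
    ; ·-homo = λ a v → trans (∑-cong λ i → pull (ε i) a (cπf w i) (cπf v (opposite i))) (∑-*ˡ {n} a _)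
    }
    where
    spread : ∀ e z a b → e * (z * (a + b)) ≈ e * (z * a) + e * (z * b)
    spread = solve 4 (λ e z a b → e :* (z :* (a :+ b)) := e :* (z :* a) :+ e :* (z :* b)) refl
    pull : ∀ e a z b → e * (z * (a * b)) ≈ a * (e * (z * b))
    pull = solve 4 (λ e a z b → e :* (z :* (a :* b)) := a :* (e :* (z :* b))) refl

  ⟦⟧-skew-diagonal : ∀ v → ⟦ v , v ⟧ ≈ - ⟦ v , v ⟧
  ⟦⟧-skew-diagonal v = begin
    ⟦ v , v ⟧                                                                 ≈⟨ ∑-reverse f ⟩
    ∑ (λ i → ε (opposite i) * (a (opposite i) * a (opposite (opposite i))))  ≈⟨ ∑-cong term ⟩
    ∑ (λ i → - f i)                                                           ≈⟨ ∑-neg f ⟩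
    - ⟦ v , v ⟧                                                               ∎
    where
    a = cπf v
    f : Fin n → Carrier
    f i = ε i * (a i * a (opposite i))
    term : ∀ i → ε (opposite i) * (a (opposite i) * a (opposite (opposite i))) ≈ - f i
    term i = begin
      ε (opposite i) * (a (opposite i) * a (opposite (opposite i)))
        ≈⟨ *-cong (ε-opposite i) (*-congˡ (reflexive (≡.cong a (opposite-involutive i)))) ⟩
      - ε i * (a (opposite i) * a i)    ≈⟨ -‿distribˡ-* (ε i) _ ⟨
      - (ε i * (a (opposite i) * a i))  ≈⟨ -‿cong (*-congˡ (*-comm _ _)) ⟩
      - f i                             ∎

  ⟦⟧-isAlternatingForm : IsField κ → CharNot2 κ → IsAlternatingForm ⟦_,_⟧
  ⟦⟧-isAlternatingForm κ-field 2≉0 = record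
    { linearˡ     = ⟦⟧-linearˡ
    ; linearʳ     = ⟦⟧-linearʳ
    ; alternating = λ v → x≈-x⇒x≈0 2≉0 (⟦⟧-skew-diagonal v)
    }
    where open FieldLinearAlgebra κ κ-field using (x≈-x⇒x≈0)

  module _ {s} {F G : Λκ → Set (c ⊔ ℓ)} (pt : SpecialFiberPoint s F G) where
    open SpecialFiberPoint pt

    tF⊆G∩G⊥′ : tImage F ⊆ G ∩ (G ⊥′)
    tF⊆G∩G⊥′ {w} (x , x∈F , w≈tx) = IsSubspace.∈-resp G-sub (λ j → sym (w≈tx j)) (tF⊆G x x∈F) , (x , w≈tx) ,
      λ g g∈G y g≈ty → begin
        ⟪ w , y ⟫       ≈⟨ ⟪⟫-congˡ y w≈tx ⟩
        ⟪ t x , y ⟫     ≈⟨ ⟪tx,y⟫≈-⟪x,ty⟫ x y ⟩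
        - ⟪ x , t y ⟫   ≈⟨ -‿cong (⟪⟫-congʳ x (λ j → sym (g≈ty j))) ⟩
        - ⟪ x , g ⟫     ≈⟨ -‿cong (F⊆F⊥ g (G⊆F g g∈G) x x∈F) ⟩
        - 0#            ≈⟨ -0#≈0# ⟩
        0#              ∎

    G∩G⊥′≐radical : G ∩ (G ⊥′) ≐ Radical ⟦_,_⟧ G
    G∩G⊥′≐radical = to , from
      where
      to : G ∩ (G ⊥′) ⊆ Radical ⟦_,_⟧ G
      to {v} (v∈G , _ , v⊥′) = v∈G , λ {g} g∈G → let (y , g≈ty) = ker-t⊆tΛ (tG≡0 g g∈G) in begin
        ⟦ v , g ⟧     ≈⟨ IsLinearForm.resp (⟦⟧-linearʳ v) g≈ty ⟩
        ⟦ v , t y ⟧   ≈⟨ ⟪w,y⟫≈⟦w,ty⟧ (tG≡0 v v∈G) y ⟨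
        ⟪ v , y ⟫     ≈⟨ v⊥′ g g∈G y g≈ty ⟩
        0#            ∎
      from : Radical ⟦_,_⟧ G ⊆ G ∩ (G ⊥′)
      from {v} (v∈G , v⊥) = v∈G , ker-t⊆tΛ (tG≡0 v v∈G) , λ g g∈G y g≈ty → begin
        ⟪ v , y ⟫     ≈⟨ ⟪w,y⟫≈⟦w,ty⟧ (tG≡0 v v∈G) y ⟩
        ⟦ v , t y ⟧   ≈⟨ IsLinearForm.resp (⟦⟧-linearʳ v) g≈ty ⟨
        ⟦ v , g ⟧     ≈⟨ v⊥ g∈G ⟩
        0#            ∎

-- Imported only here because inside the modules above _+_ is the ring addition.
open import Data.Nat using (_≤_; _+_)

lemma3p11 : ∀ {c ℓ} (κ : CommutativeRing c ℓ) → IsField κ → CharNot2 κ →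
    (m r s : ℕ) → 2 ≤ m → s ≤ r → r + s ≡ m + m →
    let open Lattice κ m in
    (F G : Λκ → Set (c ⊔ ℓ)) → SpecialFiberPoint s F G →
    (h l : ℕ) → HasDim (tImage F) h → HasDim (G ∩ (G ⊥′)) l →
    (0 ≤ h) × (h ≤ l) × (l ≤ s) × (l % 2 ≡ s % 2)
lemma3p11 κ κ-field 2≉0 m _ s _ _ _ F G pt h l tF-dim radical-dim =
    z≤n
  , dim-mono (tF⊆G∩G⊥′ pt) tF-dim radical-dim
  , dim-mono proj₁ radical-dim G-dim
  , rank-parity (⟦⟧-isAlternatingForm κ-field 2≉0) G-sub G-dim
      (hasDim-resp-≐ (G∩G⊥′≐radical pt) radical-dim)
  where
  open LinearAlgebra κ using (hasDim-resp-≐)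
  open FieldLinearAlgebra κ κ-field using (dim-mono; rank-parity)
  open SpecialFiber κ m
  open Lattice.SpecialFiberPoint pt using (G-sub; G-dim)
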